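{- Let $T$ be a subcubic tree that is not isomorphic to the path $P_3$ on three vertices, let $v$ be a vertex of degree $2$ in $T$, and let $c\in\{\text{red},\text{blue}\}$. Then $T$ admits a crumby coloring in which $v$ receives color $c$.
   Context: A graph is subcubic if it has maximum degree at most $3$. A crumby coloring of a graph $H$ is a coloring of the vertices of $H$ with two colors, red and blue, such that the subgraph induced by the blue vertices has maximum degree at most $1$, and the subgraph induced by the red vertices has minimum degree at least $1$ and contains no path with $3$ edges. -}

module Defs where

open import Data.Nat using (ℕ; _≤_)
open import Data.Bool using (Bool; true; false)
open import Data.Fin using (Fin; zero; suc)
open import Data.List using (List; []; _∷_; _++_; [_]; length; filter; allFin)
open import Data.List.Relation.Unary.Unique.Propositional using (Unique)
open import Data.List.Relation.Unary.Linked using (Linked)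
open import Data.Product using (Σ; _×_; ∃; ∃-syntax)
open import Relation.Binary.PropositionalEquality using (_≡_; _≢_)
open import Relation.Nullary using (¬_)
open import Data.Bool.Properties using () renaming (_≟_ to _≟ᵇ_)
open import Function.Bundles using (_⤖_; Bijection)

record Graph (n : ℕ) : Set where
  field
    adj   : Fin n → Fin n → Bool
    sym   : ∀ u v → adj u v ≡ adj v u
    irref : ∀ v → adj v v ≡ false
open Graph public

Adj : ∀ {n} → Graph n → Fin n → Fin n → Set
Adj G u v = adj G u v ≡ true

deg : ∀ {n} → Graph n → Fin n → ℕ
deg {n} G v = length (filter (λ u → adj G v u ≟ᵇ true) (allFin n))

Subcubic : ∀ {n} → Graph n → Set
Subcubic G = ∀ v → deg G v ≤ 3

data Walk {n} (G : Graph n) : Fin n → Fin n → Set where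
  here : ∀ {u} → Walk G u u
  step : ∀ {u w v} → Adj G u w → Walk G w v → Walk G u v

Connected : ∀ {n} → Graph n → Set
Connected G = ∀ u v → Walk G u v

HasCycle : ∀ {n} → Graph n → Set
HasCycle {n} G = Σ (Fin n) λ x → Σ (List (Fin n)) λ xs →
  (2 ≤ length xs) × Unique (x ∷ xs) × Linked (Adj G) (x ∷ xs ++ [ x ])

IsTree : ∀ {n} → Graph n → Set
IsTree G = Connected G × ¬ HasCycle G

Isomorphic : ∀ {n m} → Graph n → Graph m → Set
Isomorphic {n} {m} G H = Σ (Fin n ⤖ Fin m) λ f →
  ∀ u v → adj G u v ≡ adj H (Bijection.to f u) (Bijection.to f v)

P3adj : Fin 3 → Fin 3 → Bool
P3adj zero (suc zero) = true
P3adj (suc zero) zero = true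
P3adj (suc zero) (suc (suc zero)) = true
P3adj (suc (suc zero)) (suc zero) = true
P3adj _ _ = false

P3 : Graph 3
P3 = record { adj = P3adj ; sym = s ; irref = i }
  where
  s : ∀ u v → P3adj u v ≡ P3adj v u
  s zero zero = _≡_.refl
  s zero (suc zero) = _≡_.refl
  s zero (suc (suc zero)) = _≡_.refl
  s (suc zero) zero = _≡_.refl
  s (suc zero) (suc zero) = _≡_.refl
  s (suc zero) (suc (suc zero)) = _≡_.refl
  s (suc (suc zero)) zero = _≡_.refl
  s (suc (suc zero)) (suc zero) = _≡_.refl
  s (suc (suc zero)) (suc (suc zero)) = _≡_.refl
  i : ∀ v → P3adj v v ≡ false
  i zero = _≡_.refl
  i (suc zero) = _≡_.refl
  i (suc (suc zero)) = _≡_.refl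

data Color : Set where
  red blue : Color

Crumby : ∀ {n} → Graph n → (Fin n → Color) → Set
Crumby {n} G col =
  -- blue vertices induce a subgraph of maximum degree ≤ 1
  (∀ v → col v ≡ blue →
     ∀ u w → Adj G v u → Adj G v w → col u ≡ blue → col w ≡ blue → u ≡ w)
  × (∀ v → col v ≡ red → ∃[ u ] (Adj G v u × col u ≡ red))
  × (¬ (Σ (Fin n) λ a → Σ (Fin n) λ b → Σ (Fin n) λ c → Σ (Fin n) λ d →
          Unique (a ∷ b ∷ c ∷ d ∷ []) ×
          col a ≡ red × col b ≡ red × col c ≡ red × col d ≡ red ×
          Adj G a b × Adj G b c × Adj G c d))

{-# OPTIONS --safe #-}
-- Root the tree at v.  Then v has two children and every other vertex at most two.  A state of a
-- vertex is its colour together with the side (parent or child) of its partner: its blue neighbour,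
-- or the centre of the red star it belongs to.  Bottom-up, every vertex gets a profile, a set of
-- states each of which extends to a valid colouring of its subtree; only five profiles arise, and
-- how they combine over at most two children is checked by evaluation.  Top-down, v takes a state of
-- colour c, which fails only when both children of v are leaves, i.e. when T is P3, and every vertex
-- hands its children states from their profiles that fit its own.  Blue vertices then have at most
-- one blue neighbour and red components are stars with at least one edge, hence have no P4.
module Submission where

open import Defs
open import Data.Bool using (Bool; true; false; T; not; _∧_; _∨_; if_then_else_)
open import Data.Bool.Properties using (T-∧; T-∨; ¬-not) renaming (_≟_ to _≟ᵇ_)
open import Data.Bool.ListAction using (all; any)
open import Data.Empty using (⊥; ⊥-elim)
open import Data.Fin using (Fin; zero; suc; _≟_)
open import Data.Fin.Properties using (any?)
open import Data.List using (List; []; _∷_; _++_; [_]; map; length; last; filter; allFin; applyUpTo; applyDownFrom; concatMap)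
open import Data.List.Properties using (applyUpTo-∷ʳ; ++-assoc; length-++; length-applyUpTo; length-applyDownFrom; filter-notAll; filter-all; map-cong-local; length-map)
open import Data.List.Membership.Propositional using (_∈_; lose; find)
open import Data.List.Membership.Propositional.Properties using (∈-map⁺; ∈-map⁻; ∈-concatMap⁻; ∈-filter⁺; ∈-filter⁻; ∈-allFin; ∈-applyUpTo⁻; ∈-applyDownFrom⁻)
open import Data.List.Relation.Unary.All as All using (All; []; _∷_)
open import Data.List.Relation.Unary.AllPairs using ([]; _∷_)
import Data.List.Relation.Unary.All.Properties as All
open import Data.List.Relation.Unary.All.Properties using (all⁺)
import Data.List.Relation.Unary.Any.Properties as Any
open import Data.List.Relation.Unary.Any.Properties using (any⁻)
open import Data.List.Relation.Binary.Pointwise using (Pointwise; []; _∷_; Pointwise-length)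
open import Data.List.Relation.Unary.Any using (here; there)
open import Data.List.Relation.Unary.Linked using (Linked)
import Data.List.Relation.Unary.Linked.Properties as Linked
open import Data.List.Relation.Unary.Unique.Propositional using (Unique)
import Data.List.Relation.Unary.Unique.Propositional.Properties as Unique
open import Data.Maybe using (just)
import Data.Maybe.Relation.Binary.Connected as Maybe
open import Data.Nat using (ℕ; zero; suc; pred; _+_; _∸_; _≤_; _<_; s≤s) renaming (_≟_ to _≟ℕ_)
open import Data.Nat.Properties using (≤-antisym; ≤-refl; ≤-reflexive; n≤1+n; ≤-trans; <-trans; <⇒≱; n<1⇒n≡0; ≤-pred; <⇒≤; <⇒≢; <-≤-trans; ≮⇒≥; 1+n≰n; n≤0⇒n≡0; m<1+n⇒m<n∨m≡n; +-identityʳ; +-suc; pred[m∸n]≡m∸[1+n]; m<n⇒0<n∸m; n∸n≡0; ∸-cancelˡ-≡; m∸n≤m; +-∸-assoc; ≤-totalOrder; m≤m+n; +-mono-≤; suc-injective; <-cmp)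
open import Data.List.Extrema ≤-totalOrder using (max; xs≤max)
open import Data.Product using (Σ; _×_; _,_; proj₁; proj₂; ∃-syntax)
open import Data.Sum as Sum using (_⊎_; inj₁; inj₂)
open import Function using (case_of_; _∘_)
open import Function.Bundles using (Equivalence; mk↔ₛ′)
open import Function.Properties.Inverse using (↔⇒⤖)
open import Relation.Binary using (tri<; tri≈; tri>)
open import Relation.Binary.PropositionalEquality as ≡ using (_≡_; _≢_; refl; cong; cong₂; subst; trans; ≢-sym; module ≡-Reasoning)
open import Relation.Nullary using (¬_; yes; no; does; contradiction)
open import Relation.Nullary.Decidable using (_×-dec_; _⊎-dec_)
open import Relation.Unary using (Decidable)

open ≡-Reasoning

record Least (P : ℕ → Set) : Set where
  field
    value   : ℕ
    holds   : P value
    minimal : ∀ {k} → P k → value ≤ k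

least : ∀ {P : ℕ → Set} → Decidable P → ∀ {m} → P m → Least P
least {P} P? {m} pm = search 0 m pm (λ ())
  where
  search : ∀ i k → P (i + k) → (∀ {j} → j < i → ¬ P j) → Least P
  search i k p below with P? i
  ... | yes pi = record { value = i ; holds = pi ; minimal = λ pj → ≮⇒≥ (λ j<i → below j<i pj) }
  search i zero    p below | no ¬pi = contradiction (subst P (+-identityʳ i) p) ¬pi
  search i (suc k) p below | no ¬pi = search (suc i) k (subst P (+-suc i k) p) below′
    where
    below′ : ∀ {j} → j < suc i → ¬ P j
    below′ j<1+i with m<1+n⇒m<n∨m≡n j<1+i
    ... | inj₁ j<i  = below j<i
    ... | inj₂ refl = ¬pi

last-applyDownFrom : ∀ {A : Set} (f : ℕ → A) l → last (applyDownFrom f (suc l)) ≡ just (f 0)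
last-applyDownFrom f zero    = refl
last-applyDownFrom f (suc l) = last-applyDownFrom f l

firstWith : ∀ {A : Set} → (A → Bool) → A → List A → A
firstWith p d []       = d
firstWith p d (x ∷ xs) = if p x then x else firstWith p d xs

firstWith-spec : ∀ {A : Set} (p : A → Bool) d xs → T (any p xs) →
                 firstWith p d xs ∈ xs × T (p (firstWith p d xs))
firstWith-spec p d (x ∷ xs) h with p x in eq
... | true  = here refl , subst T (≡.sym eq) _
... | false = let m , q = firstWith-spec p d xs h in there m , q

atMostOne : ∀ {A : Set} → (A → Bool) → List A → Bool
atMostOne p []       = true
atMostOne p (x ∷ xs) = if p x then all (λ y → not (p y)) xs else atMostOne p xs

T-not⇒¬T : ∀ {b} → T (not b) → ¬ T b
T-not⇒¬T {true}  () _
T-not⇒¬T {false} _  ()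

all-map-∈ : ∀ {A B : Set} (p : B → Bool) (f : A → B) {xs x} → T (all p (map f xs)) → x ∈ xs → T (p (f x))
all-map-∈ p f {xs} h = All.lookup (All.map⁻ (all⁺ p (map f xs) h))

any-map : ∀ {A B : Set} (p : B → Bool) (f : A → B) {xs} → T (any p (map f xs)) → ∃[ x ] (x ∈ xs × T (p (f x)))
any-map p f {xs} h = find (Any.map⁻ (any⁻ p (map f xs) h))

atMostOne-map : ∀ {A B : Set} (p : B → Bool) (f : A → B) {xs x y} →
                T (atMostOne p (map f xs)) → Unique xs →
                x ∈ xs → y ∈ xs → T (p (f x)) → T (p (f y)) → x ≡ y
atMostOne-map p f {z ∷ xs} h (_ ∷ u) mx my px py with p (f z) in eq | mx | my
... | true  | here refl  | here refl  = refl
... | true  | here refl  | there my′  = ⊥-elim (T-not⇒¬T (all-map-∈ (λ b → not (p b)) f h my′) py)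
... | true  | there mx′  | _          = ⊥-elim (T-not⇒¬T (all-map-∈ (λ b → not (p b)) f h mx′) px)
... | false | here refl  | _          = ⊥-elim (subst T eq px)
... | false | there _    | here refl  = ⊥-elim (subst T eq py)
... | false | there mx′  | there my′  = atMostOne-map p f h u mx′ my′ px py

Pointwise-map-∈ : ∀ {A B C : Set} {R : B → C → Set} {f : A → B} {g : A → C} {xs x} →
                  Pointwise R (map f xs) (map g xs) → x ∈ xs → R (f x) (g x)
Pointwise-map-∈ {xs = _ ∷ _} (r ∷ _)  (here refl) = r
Pointwise-map-∈ {xs = _ ∷ _} (_ ∷ rs) (there m)   = Pointwise-map-∈ rs m

assign : ∀ {n} {A : Set} → List (Fin n) → List A → A → Fin n → A
assign (x ∷ xs) (a ∷ as) d w = if does (w ≟ x) then a else assign xs as d w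
assign _        _        d w = d

map-assign : ∀ {n} {A : Set} (xs : List (Fin n)) (as : List A) d → Unique xs → length as ≡ length xs →
             map (assign xs as d) xs ≡ as
map-assign []       []       d _          _   = refl
map-assign (x ∷ xs) (a ∷ as) d (x∉ ∷ u) len =
  cong₂ _∷_ assign-head (trans (map-cong-local (All.map assign-skip x∉)) (map-assign xs as d u (suc-injective len)))
  where
  assign-head : assign (x ∷ xs) (a ∷ as) d x ≡ a
  assign-head with x ≟ x
  ... | yes _   = refl
  ... | no x≢x = contradiction refl x≢x
  assign-skip : ∀ {y} → x ≢ y → assign (x ∷ xs) (a ∷ as) d y ≡ assign xs as d y
  assign-skip {y} x≢y with y ≟ x
  ... | yes y≡x = contradiction (≡.sym y≡x) x≢y
  ... | no _    = refl

-- Graphs and rooted trees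

module Adjacency {n} (G : Graph n) where

  adj? : ∀ u → Decidable (Adj G u)
  adj? u w = adj G u w ≟ᵇ true

  Adj-sym : ∀ {u w} → Adj G u w → Adj G w u
  Adj-sym {u} {w} e = trans (sym G w u) e

  Adj-irrefl : ∀ {u w} → Adj G u w → u ≢ w
  Adj-irrefl {u} e refl = case trans (≡.sym (irref G u)) e of λ ()

  -- The cycle runs down f from f l to f 0, crosses to g 0 and climbs g back to g m = f l.
  closed-chains⇒cycle : (f g : ℕ → Fin n) (l m : ℕ) → 2 ≤ l + m →
    (∀ {k} → suc k < suc l → Adj G (f (suc k)) (f k)) →
    Adj G (f 0) (g 0) →
    (∀ {k} → suc k < suc m → Adj G (g k) (g (suc k))) →
    g m ≡ f l →
    (∀ {j k} → j < k → k < suc l → f k ≢ f j) →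
    (∀ {j k} → j < k → k < m → g j ≢ g k) →
    (∀ {j k} → k < suc l → j < m → f k ≢ g j) →
    HasCycle G
  closed-chains⇒cycle f g l m long f-adj bridge g-adj meet f-inj g-inj f≢g =
    f l , xs , length-xs , unique , subst (Linked (Adj G)) closes linked
    where
    xs : List (Fin n)
    xs = applyDownFrom f l ++ applyUpTo g m

    length-xs : 2 ≤ length xs
    length-xs = subst (2 ≤_) (≡.sym (trans (length-++ (applyDownFrom f l))
                  (cong₂ _+_ (length-applyDownFrom f l) (length-applyUpTo g m)))) long

    unique : Unique (f l ∷ xs)
    unique = Unique.++⁺ (Unique.applyDownFrom⁺₁ f (suc l) f-inj) (Unique.applyUpTo⁺₁ g m g-inj) disjoint
      where
      disjoint : ∀ {z} → ¬ (z ∈ applyDownFrom f (suc l) × z ∈ applyUpTo g m)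
      disjoint (p , q) with ∈-applyDownFrom⁻ f p | ∈-applyUpTo⁻ g q
      ... | k , k< , refl | j , j< , eq = f≢g k< j< eq

    linked : Linked (Adj G) (applyDownFrom f (suc l) ++ applyUpTo g (suc m))
    linked = Linked.++⁺ (Linked.applyDownFrom⁺₁ f (suc l) f-adj)
      (subst (λ z → Maybe.Connected (Adj G) z (just (g 0))) (≡.sym (last-applyDownFrom f l)) (Maybe.just bridge))
      (Linked.applyUpTo⁺₁ g (suc m) g-adj)

    closes : applyDownFrom f (suc l) ++ applyUpTo g (suc m) ≡ f l ∷ xs ++ [ f l ]
    closes = begin
      f l ∷ applyDownFrom f l ++ applyUpTo g (suc m)        ≡⟨ cong (λ ys → f l ∷ applyDownFrom f l ++ ys) (applyUpTo-∷ʳ g m) ⟨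
      f l ∷ applyDownFrom f l ++ (applyUpTo g m ++ [ g m ]) ≡⟨ cong (λ z → f l ∷ applyDownFrom f l ++ (applyUpTo g m ++ [ z ])) meet ⟩
      f l ∷ applyDownFrom f l ++ (applyUpTo g m ++ [ f l ]) ≡⟨ cong (f l ∷_) (++-assoc (applyDownFrom f l) (applyUpTo g m) [ f l ]) ⟨
      f l ∷ xs ++ [ f l ]                                   ∎

module RootedTree {n} (G : Graph n) (connected : Connected G) (acyclic : ¬ HasCycle G) (root : Fin n) where

  open Adjacency G public

  Within : ℕ → Fin n → Set
  Within zero    w = w ≡ root
  Within (suc k) w = Within k w ⊎ ∃[ x ] (Adj G w x × Within k x)

  within? : ∀ k → Decidable (Within k)
  within? zero    w = w ≟ root
  within? (suc k) w = within? k w ⊎-dec any? (λ x → adj? w x ×-dec within? k x)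

  walk⇒within : ∀ {w} → Walk G w root → ∃[ k ] Within k w
  walk⇒within here = 0 , refl
  walk⇒within (step e p) with walk⇒within p
  ... | k , x∈k = suc k , inj₂ (_ , e , x∈k)

  -- Abstract, so that the with-abstraction over w ≟ root in parent does not reach inside depth w.
  abstract
    depthOf : ∀ w → Least (λ k → Within k w)
    depthOf w = least (λ k → within? k w) (proj₂ (walk⇒within (connected w root)))

    depth : Fin n → ℕ
    depth w = Least.value (depthOf w)

    within-depth : ∀ w → Within (depth w) w
    within-depth w = Least.holds (depthOf w)

    depth-minimal : ∀ {k w} → Within k w → depth w ≤ k
    depth-minimal {w = w} = Least.minimal (depthOf w)

  depth-root : depth root ≡ 0
  depth-root = n≤0⇒n≡0 (depth-minimal {0} refl)

  depth≡0⇒root : ∀ {w} → depth w ≡ 0 → w ≡ root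
  depth≡0⇒root {w} eq = subst (λ k → Within k w) eq (within-depth w)

  depth≡suc⇒≢root : ∀ {w k} → depth w ≡ suc k → w ≢ root
  depth≡suc⇒≢root eq refl = case trans (≡.sym eq) depth-root of λ ()

  depth-adj : ∀ {w x} → Adj G w x → depth w ≤ suc (depth x)
  depth-adj e = depth-minimal (inj₂ (_ , e , within-depth _))

  ∃parent : ∀ {w} → w ≢ root → ∃[ x ] (Adj G w x × suc (depth x) ≡ depth w)
  ∃parent {w} w≢root with depth w in eq | within-depth w
  ... | zero  | w≡root = contradiction w≡root w≢root
  ... | suc k | inj₁ w∈k = contradiction (subst (_≤ k) eq (depth-minimal w∈k)) 1+n≰n
  ... | suc k | inj₂ (x , e , x∈k) =
    x , e , cong suc (≤-antisym (depth-minimal x∈k) (≤-pred (subst (_≤ suc (depth x)) eq (depth-adj e))))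

  parent : Fin n → Fin n
  parent w with w ≟ root
  ... | yes _      = root
  ... | no w≢root = proj₁ (∃parent w≢root)

  parent-spec : ∀ {w} → w ≢ root → Adj G w (parent w) × suc (depth (parent w)) ≡ depth w
  parent-spec {w} w≢root with w ≟ root
  ... | yes w≡root = contradiction w≡root w≢root
  ... | no w≢root′ = proj₂ (∃parent w≢root′)

  parent-adj : ∀ {w} → w ≢ root → Adj G w (parent w)
  parent-adj w≢root = proj₁ (parent-spec w≢root)

  parent-depth : ∀ {w} → w ≢ root → suc (depth (parent w)) ≡ depth w
  parent-depth w≢root = proj₂ (parent-spec w≢root)

  depth-parent : ∀ w → depth (parent w) ≡ pred (depth w)
  depth-parent w with w ≟ root
  ... | yes refl   = trans depth-root (cong pred (≡.sym depth-root))
  ... | no w≢root = cong pred (proj₂ (proj₂ (∃parent w≢root)))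

  depth-parent-suc : ∀ {w k} → depth w ≡ suc k → depth (parent w) ≡ k
  depth-parent-suc {w} eq = trans (depth-parent w) (cong pred eq)

  ancestor : ℕ → Fin n → Fin n
  ancestor zero    w = w
  ancestor (suc k) w = parent (ancestor k w)

  depth-ancestor : ∀ k w → depth (ancestor k w) ≡ depth w ∸ k
  depth-ancestor zero    w = refl
  depth-ancestor (suc k) w = begin
    depth (parent (ancestor k w)) ≡⟨ depth-parent (ancestor k w) ⟩
    pred (depth (ancestor k w))   ≡⟨ cong pred (depth-ancestor k w) ⟩
    pred (depth w ∸ k)            ≡⟨ pred[m∸n]≡m∸[1+n] (depth w) k ⟩
    depth w ∸ suc k               ∎

  ancestor-depth : ∀ w → ancestor (depth w) w ≡ root
  ancestor-depth w = depth≡0⇒root (trans (depth-ancestor (depth w) w) (n∸n≡0 (depth w)))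

  ancestor-adj : ∀ {k w} → k < depth w → Adj G (ancestor k w) (ancestor (suc k) w)
  ancestor-adj {k} {w} k<d = parent-adj λ eq →
    <⇒≢ (m<n⇒0<n∸m k<d) (≡.sym (trans (≡.sym (depth-ancestor k w)) (trans (cong depth eq) depth-root)))

  ancestor-≢-deeper : ∀ j w {u} → depth w < depth u → ancestor j w ≢ u
  ancestor-≢-deeper j w w<u refl = <⇒≱ w<u (subst (_≤ depth w) (≡.sym (depth-ancestor j w)) (m∸n≤m (depth w) j))

  ancestor-level : ∀ {w w′ j k} → depth w ≡ depth w′ → j ≤ depth w → k ≤ depth w →
                   ancestor j w ≡ ancestor k w′ → j ≡ k
  ancestor-level {w} {w′} {j} {k} same j≤ k≤ eq = ∸-cancelˡ-≡ j≤ k≤ (begin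
    depth w ∸ j            ≡⟨ depth-ancestor j w ⟨
    depth (ancestor j w)   ≡⟨ cong depth eq ⟩
    depth (ancestor k w′)  ≡⟨ depth-ancestor k w′ ⟩
    depth w′ ∸ k           ≡⟨ cong (_∸ k) same ⟨
    depth w ∸ k            ∎)

  -- The ancestor chains of a and b first meet at some level i ≥ 1; an edge between a and b, or a
  -- common neighbour one level below them, would close the two chains into a cycle.
  module SameDepth {a b} (a≢b : a ≢ b) (same : depth a ≡ depth b) where

    private
      A B : ℕ → Fin n
      A k = ancestor k a
      B k = ancestor k b

      meet-at-root : A (depth a) ≡ B (depth a)
      meet-at-root = trans (ancestor-depth a) (≡.sym (subst (λ k → B k ≡ root) (≡.sym same) (ancestor-depth b)))

      meeting : Least (λ k → A k ≡ B k)
      meeting = least (λ k → A k ≟ B k) {depth a} meet-at-root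

      i : ℕ
      i = Least.value meeting

      A≡B : A i ≡ B i
      A≡B = Least.holds meeting

      A≢B : ∀ {j} → j < i → A j ≢ B j
      A≢B j<i eq = <⇒≱ j<i (Least.minimal meeting eq)

      i≤depth : i ≤ depth a
      i≤depth = Least.minimal meeting {depth a} meet-at-root

      1≤i : 1 ≤ i
      1≤i = ≮⇒≥ (λ i<1 → a≢b (subst (λ k → A k ≡ B k) (n<1⇒n≡0 i<1) A≡B))

      <i⇒<depth : ∀ {k} → k < i → k < depth a
      <i⇒<depth k<i = <-≤-trans k<i i≤depth

      A-adj : ∀ {k} → suc k < suc i → Adj G (A k) (A (suc k))
      A-adj (s≤s k<i) = ancestor-adj (<i⇒<depth k<i)

      B-adj : ∀ {k} → suc k < suc i → Adj G (B (suc k)) (B k)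
      B-adj (s≤s k<i) = Adj-sym (ancestor-adj (subst (_ <_) same (<i⇒<depth k<i)))

      A-inj : ∀ {j k} → j < k → k < i → A j ≢ A k
      A-inj j<k k<i eq = <⇒≢ j<k (ancestor-level refl (<⇒≤ (<i⇒<depth (<-trans j<k k<i))) (<⇒≤ (<i⇒<depth k<i)) eq)

      B-inj : ∀ {j k} → j < k → k < suc i → B k ≢ B j
      B-inj j<k (s≤s k≤i) eq =
        <⇒≢ j<k (≡.sym (ancestor-level refl (subst (_ ≤_) same (≤-trans k≤i i≤depth))
                                             (subst (_ ≤_) same (≤-trans (<⇒≤ j<k) (≤-trans k≤i i≤depth))) eq))

      B≢A : ∀ {j k} → k < suc i → j < i → B k ≢ A j
      B≢A {j} {k} (s≤s k≤i) j<i eq with ancestor-level (≡.sym same) (subst (_ ≤_) same (≤-trans k≤i i≤depth))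
                                                        (subst (_ ≤_) same (<⇒≤ (<i⇒<depth j<i))) eq
      ... | refl = A≢B j<i (≡.sym eq)

    no-edge : ¬ Adj G a b
    no-edge e = acyclic (closed-chains⇒cycle B A i i (+-mono-≤ 1≤i 1≤i) B-adj (Adj-sym e) A-adj A≡B B-inj A-inj B≢A)

    no-deeper-common-neighbour : ∀ {u} → Adj G u a → Adj G u b → depth u ≡ suc (depth a) → ⊥
    no-deeper-common-neighbour {u} ua ub du =
      acyclic (closed-chains⇒cycle uB A (suc i) i (s≤s (≤-trans 1≤i (m≤m+n i i))) uB-adj ua A-adj A≡B uB-inj A-inj uB≢A)
      where
      uB : ℕ → Fin n
      uB zero    = u
      uB (suc k) = B k

      a<u : depth a < depth u
      a<u = subst (depth a <_) (≡.sym du) ≤-refl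

      uB-adj : ∀ {k} → suc k < suc (suc i) → Adj G (uB (suc k)) (uB k)
      uB-adj {zero}  _         = Adj-sym ub
      uB-adj {suc k} (s≤s k<i) = B-adj k<i

      uB-inj : ∀ {j k} → j < k → k < suc (suc i) → uB k ≢ uB j
      uB-inj {zero}  {suc k} _         _          = ancestor-≢-deeper k b (subst (_< depth u) same a<u)
      uB-inj {suc j} {suc k} (s≤s j<k) (s≤s k<) = B-inj j<k k<

      uB≢A : ∀ {j k} → k < suc (suc i) → j < i → uB k ≢ A j
      uB≢A {j} {zero}  _        _   = ≢-sym (ancestor-≢-deeper j a a<u)
      uB≢A {j} {suc k} (s≤s k<) j<i = B≢A k< j<i

  adjacent⇒depth≢ : ∀ {w x} → Adj G w x → depth w ≢ depth x
  adjacent⇒depth≢ e same = SameDepth.no-edge (Adj-irrefl e) same e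

  parent-unique : ∀ {w x} → Adj G w x → suc (depth x) ≡ depth w → x ≡ parent w
  parent-unique {w} {x} e eq with x ≟ parent w
  ... | yes x≡p = x≡p
  ... | no  x≢p = contradiction (≡.sym eq)
        (SameDepth.no-deeper-common-neighbour x≢p same e (parent-adj w≢root))
    where
    w≢root : w ≢ root
    w≢root = depth≡suc⇒≢root (≡.sym eq)
    same : depth x ≡ depth (parent w)
    same = suc-injective (trans eq (≡.sym (parent-depth w≢root)))

  neighbours : Fin n → List (Fin n)
  neighbours w = filter (adj? w) (allFin n)

  OneBelow : Fin n → Fin n → Set
  OneBelow w x = depth x ≡ suc (depth w)

  children : Fin n → List (Fin n)
  children w = filter (λ x → depth x ≟ℕ suc (depth w)) (neighbours w)

  children-unique : ∀ w → Unique (children w)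
  children-unique w = Unique.filter⁺ _ (Unique.filter⁺ (adj? w) (Unique.allFin⁺ n))

  ∈children⁺ : ∀ {w x} → Adj G w x → OneBelow w x → x ∈ children w
  ∈children⁺ {w} {x} e below = ∈-filter⁺ _ (∈-filter⁺ (adj? w) (∈-allFin x) e) below

  child-adj : ∀ {w x} → x ∈ children w → Adj G w x
  child-adj {w} m = proj₂ (∈-filter⁻ (adj? w) {xs = allFin n} (proj₁ (∈-filter⁻ _ {xs = neighbours w} m)))

  child-depth : ∀ {w x} → x ∈ children w → OneBelow w x
  child-depth {w} m = proj₂ (∈-filter⁻ _ {xs = neighbours w} m)

  child-≢root : ∀ {w x} → x ∈ children w → x ≢ root
  child-≢root m = depth≡suc⇒≢root (child-depth m)

  parent-child : ∀ {w x} → x ∈ children w → parent x ≡ w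
  parent-child m = ≡.sym (parent-unique (Adj-sym (child-adj m)) (≡.sym (child-depth m)))

  child-parent : ∀ {w} → w ≢ root → w ∈ children (parent w)
  child-parent w≢root = ∈children⁺ (Adj-sym (parent-adj w≢root)) (≡.sym (parent-depth w≢root))

  adj-cases : ∀ {w x} → Adj G w x → (w ≢ root × x ≡ parent w) ⊎ x ∈ children w
  adj-cases {w} {x} e with <-cmp (depth w) (depth x)
  ... | tri< w<x _ _  = inj₂ (∈children⁺ e (≤-antisym (depth-adj (Adj-sym e)) w<x))
  ... | tri≈ _ same _ = contradiction same (adjacent⇒depth≢ e)
  ... | tri> _ _ x<w  = inj₁ (depth≡suc⇒≢root w≡1+x , parent-unique e (≡.sym w≡1+x))
    where
    w≡1+x : depth w ≡ suc (depth x)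
    w≡1+x = ≤-antisym (depth-adj e) x<w

  not-child⇒parent : ∀ {w x} → Adj G w x → ¬ x ∈ children w → x ≡ parent w
  not-child⇒parent e x∉ with adj-cases e
  ... | inj₁ (_ , x≡parent) = x≡parent
  ... | inj₂ x∈            = contradiction x∈ x∉

  not-parent⇒child : ∀ {w x} → Adj G w x → (w ≢ root → x ≢ parent w) → x ∈ children w
  not-parent⇒child e x≢parent with adj-cases e
  ... | inj₁ (w≢root , x≡parent) = contradiction x≡parent (x≢parent w≢root)
  ... | inj₂ x∈                 = x∈

  children-count : ∀ {w} → w ≢ root → deg G w ≤ 3 → length (children w) ≤ 2
  children-count {w} w≢root deg≤3 =
    ≤-pred (<-≤-trans (filter-notAll _ (neighbours w) (lose parent∈ parent-not-below)) deg≤3)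
    where
    parent∈ : parent w ∈ neighbours w
    parent∈ = ∈-filter⁺ (adj? w) (∈-allFin (parent w)) (parent-adj w≢root)
    parent-not-below : ¬ OneBelow w (parent w)
    parent-not-below eq = 1+n≰n (≤-trans (n≤1+n _) (≤-reflexive (trans (cong suc (≡.sym eq)) (parent-depth w≢root))))

  root-children : deg G root ≡ 2 → length (children root) ≡ 2
  root-children deg≡2 = trans (cong length (filter-all _ (All.tabulate below))) deg≡2
    where
    below : ∀ {x} → x ∈ neighbours root → OneBelow root x
    below {x} m with adj-cases (proj₂ (∈-filter⁻ (adj? root) {xs = allFin n} m))
    ... | inj₁ (root≢root , _) = contradiction refl root≢root
    ... | inj₂ x∈children      = child-depth x∈children

  module Cherry {x y} (root-children≡ : children root ≡ x ∷ y ∷ [])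
                (x-leaf : children x ≡ []) (y-leaf : children y ≡ []) where

    private
      x∈ : x ∈ children root
      x∈ = subst (x ∈_) (≡.sym root-children≡) (here refl)

      y∈ : y ∈ children root
      y∈ = subst (y ∈_) (≡.sym root-children≡) (there (here refl))

      x≢y : x ≢ y
      x≢y with subst Unique root-children≡ (children-unique root)
      ... | (x≢y ∷ []) ∷ _ = x≢y

      childless : ∀ {w z} → w ≡ x ⊎ w ≡ y → z ∈ children w → ⊥
      childless (inj₁ refl) m = case subst (_ ∈_) x-leaf m of λ ()
      childless (inj₂ refl) m = case subst (_ ∈_) y-leaf m of λ ()

      depth-1 : ∀ {w} → depth w ≡ 1 → w ≡ x ⊎ w ≡ y
      depth-1 {w} d≡1 = case subst (w ∈_) root-children≡ w∈ of λ where
          (here w≡x)         → inj₁ w≡x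
          (there (here w≡y)) → inj₂ w≡y
        where
        w∈ : w ∈ children root
        w∈ = subst (λ p → w ∈ children p) (depth≡0⇒root (depth-parent-suc d≡1)) (child-parent (depth≡suc⇒≢root d≡1))

      no-depth-2+ : ∀ k {w} → depth w ≡ suc (suc k) → ⊥
      no-depth-2+ zero    d≡ = childless (depth-1 (depth-parent-suc d≡)) (child-parent (depth≡suc⇒≢root d≡))
      no-depth-2+ (suc k) d≡ = no-depth-2+ k (depth-parent-suc d≡)

      vertex-cases : ∀ w → w ≡ x ⊎ w ≡ root ⊎ w ≡ y
      vertex-cases w with depth w in d≡
      ... | zero        = inj₂ (inj₁ (depth≡0⇒root d≡))
      ... | suc zero    = Sum.map₂ inj₂ (depth-1 d≡)
      ... | suc (suc k) = ⊥-elim (no-depth-2+ k d≡)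

      x-y-not-adjacent : adj G x y ≡ false
      x-y-not-adjacent = ¬-not λ e → case adj-cases e of λ where
        (inj₁ (_ , y≡parent)) → child-≢root y∈ (trans y≡parent (parent-child x∈))
        (inj₂ y∈children-x)   → childless (inj₁ refl) y∈children-x

      from : Fin 3 → Fin n
      from zero             = x
      from (suc zero)       = root
      from (suc (suc zero)) = y

      to : Fin n → Fin 3
      to w with w ≟ x | w ≟ root
      ... | yes _ | _     = zero
      ... | no _  | yes _ = suc zero
      ... | no _  | no _  = suc (suc zero)

      to-from : ∀ i → to (from i) ≡ i
      to-from zero with x ≟ x
      ... | yes _   = refl
      ... | no x≢x = contradiction refl x≢x
      to-from (suc zero) with root ≟ x | root ≟ root
      ... | yes root≡x | _         = contradiction (≡.sym root≡x) (child-≢root x∈)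
      ... | no _       | yes _     = refl
      ... | no _       | no r≢r    = contradiction refl r≢r
      to-from (suc (suc zero)) with y ≟ x | y ≟ root
      ... | yes y≡x | _        = contradiction (≡.sym y≡x) x≢y
      ... | no _    | yes y≡r  = contradiction y≡r (child-≢root y∈)
      ... | no _    | no _     = refl

      from-to : ∀ w → from (to w) ≡ w
      from-to w with vertex-cases w
      ... | inj₁ refl         = cong from (to-from zero)
      ... | inj₂ (inj₁ refl)  = cong from (to-from (suc zero))
      ... | inj₂ (inj₂ refl)  = cong from (to-from (suc (suc zero)))

      adj-from : ∀ i j → adj G (from i) (from j) ≡ P3adj i j
      adj-from zero             zero             = irref G x
      adj-from zero             (suc zero)       = Adj-sym (child-adj x∈)
      adj-from zero             (suc (suc zero)) = x-y-not-adjacent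
      adj-from (suc zero)       zero             = child-adj x∈
      adj-from (suc zero)       (suc zero)       = irref G root
      adj-from (suc zero)       (suc (suc zero)) = child-adj y∈
      adj-from (suc (suc zero)) zero             = trans (sym G y x) x-y-not-adjacent
      adj-from (suc (suc zero)) (suc zero)       = Adj-sym (child-adj y∈)
      adj-from (suc (suc zero)) (suc (suc zero)) = irref G y

    cherry≅P3 : Isomorphic G P3
    cherry≅P3 = ↔⇒⤖ (mk↔ₛ′ to from to-from from-to) , λ u w → begin
      adj G u w                         ≡⟨ cong₂ (adj G) (from-to u) (from-to w) ⟨
      adj G (from (to u)) (from (to w)) ≡⟨ adj-from (to u) (to w) ⟩
      P3adj (to u) (to w)               ∎

-- Local colouring rules

-- Red vertices will induce stars.  A state records the colour of a vertex and where its partner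
-- lies in the rooted tree: blue↑ and blue↓ are blue vertices whose blue neighbour, if any, is the
-- parent, resp. a child; centre is the centre of a red star, leaf↑ a red leaf whose centre is the
-- parent and leaf↓ a red leaf whose centre is a child.
data State : Set where
  blue↑ blue↓ leaf↑ leaf↓ centre : State

colour : State → Color
colour blue↑ = blue
colour blue↓ = blue
colour _     = red

isBlue : State → Bool
isBlue blue↑ = true
isBlue blue↓ = true
isBlue _     = false

isRed : State → Bool
isRed s = not (isBlue s)

blue⇒isBlue : ∀ {s} → colour s ≡ blue → T (isBlue s)
blue⇒isBlue {blue↑} _ = _
blue⇒isBlue {blue↓} _ = _

isRed⇒red : ∀ {s} → T (isRed s) → colour s ≡ red
isRed⇒red {leaf↑}  _ = refl
isRed⇒red {leaf↓}  _ = refl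
isRed⇒red {centre} _ = refl

red⇒isRed : ∀ {s} → colour s ≡ red → T (isRed s)
red⇒isRed {leaf↑}  _ = _
red⇒isRed {leaf↓}  _ = _
red⇒isRed {centre} _ = _

blue⇒¬isRed : ∀ {s} → colour s ≡ blue → ¬ T (isRed s)
blue⇒¬isRed {blue↑} _ ()
blue⇒¬isRed {blue↓} _ ()

red⇒¬isBlue : ∀ {s} → colour s ≡ red → ¬ T (isBlue s)
red⇒¬isBlue {leaf↑}  _ ()
red⇒¬isBlue {leaf↓}  _ ()
red⇒¬isBlue {centre} _ ()

isLeaf↑ : State → Bool
isLeaf↑ leaf↑ = true
isLeaf↑ _     = false

fitsUnder : State → State → Bool
fitsUnder p blue↓ = isRed p
fitsUnder p leaf↑ = isRed p
fitsUnder p leaf↓ = isBlue p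
fitsUnder p _     = true

childrenOK : State → List State → Bool
childrenOK blue↑  cs = all isRed cs
childrenOK blue↓  cs = atMostOne isBlue cs
childrenOK leaf↑  cs = all isBlue cs
childrenOK leaf↓  cs = any isRed cs ∧ atMostOne isRed cs
childrenOK centre cs = any isRed cs ∧ all (λ c → isBlue c ∨ isLeaf↑ c) cs

admits : State → List State → Bool
admits s cs = all (fitsUnder s) cs ∧ childrenOK s cs

-- A profile is a set of states each of which can be realised on a subtree; it is named after
-- its states.  The five profiles below are closed under combining at most two children.
data Profile : Set where
  B↑L↑ B↑C B↑L↑L↓ B↓L↓C L↑C : Profile

states : Profile → List State
states B↑L↑   = blue↑ ∷ leaf↑ ∷ []
states B↑C    = blue↑ ∷ centre ∷ []
states B↑L↑L↓ = blue↑ ∷ leaf↑ ∷ leaf↓ ∷ []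
states B↓L↓C  = blue↓ ∷ leaf↓ ∷ centre ∷ []
states L↑C    = leaf↑ ∷ centre ∷ []

leafy : Profile → Bool
leafy B↑L↑ = true
leafy _    = false

combine₁ : Profile → Profile
combine₁ B↑L↑   = B↓L↓C
combine₁ B↑C    = B↑L↑L↓
combine₁ B↑L↑L↓ = B↑C
combine₁ B↓L↓C  = B↑L↑L↓
combine₁ L↑C    = B↑C

combine₂ : Profile → Profile → Profile
combine₂ B↑L↑   B↑L↑   = L↑C
combine₂ B↑L↑   _      = B↓L↓C
combine₂ _      B↑L↑   = B↓L↓C
combine₂ B↑C    B↑C    = B↑L↑L↓
combine₂ B↑C    B↓L↓C  = B↑L↑L↓
combine₂ B↓L↓C  B↑C    = B↑L↑L↓
combine₂ B↓L↓C  B↓L↓C  = B↑L↑L↓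
combine₂ _      _      = B↑C

-- The value on three or more profiles is junk: no vertex has more than two children.
combine : List Profile → Profile
combine []             = B↑L↑
combine (t ∷ [])       = combine₁ t
combine (t₁ ∷ t₂ ∷ []) = combine₂ t₁ t₂
combine _              = B↑C

InProfiles : List State → List Profile → Set
InProfiles = Pointwise (λ s t → s ∈ states t)

choices : List Profile → List (List State)
choices []       = [ [] ]
choices (t ∷ ts) = concatMap (λ c → map (c ∷_) (choices ts)) (states t)

realisable : State → List Profile → Bool
realisable s ts = any (admits s) (choices ts)

choose : State → List Profile → List State
choose s ts = firstWith (admits s) [] (choices ts)

-- leaf↑ is excluded: the root has no parent to be the centre of its star.
rootCandidates : Color → List State
rootCandidates blue = blue↑ ∷ blue↓ ∷ []
rootCandidates red  = centre ∷ leaf↓ ∷ []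

rootState : Color → List Profile → State
rootState c ts = firstWith (λ s → realisable s ts) blue↑ (rootCandidates c)

∈-choices⁻ : ∀ {cs} ts → cs ∈ choices ts → InProfiles cs ts
∈-choices⁻ []       (here refl) = []
∈-choices⁻ (t ∷ ts) m with find (∈-concatMap⁻ (λ c → map (c ∷_) (choices ts)) {xs = states t} m)
... | c , c∈ , m′ with ∈-map⁻ (c ∷_) m′
... | ds , ds∈ , refl = c∈ ∷ ∈-choices⁻ ts ds∈

choose-spec : ∀ {s ts} → T (realisable s ts) →
              T (admits s (choose s ts)) × InProfiles (choose s ts) ts
choose-spec {s} {ts} h =
  let m , ok = firstWith-spec (admits s) [] (choices ts) h in ok , ∈-choices⁻ ts m

profiles : List Profile
profiles = B↑L↑ ∷ B↑C ∷ B↑L↑L↓ ∷ B↓L↓C ∷ L↑C ∷ []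

∈-profiles : ∀ t → t ∈ profiles
∈-profiles B↑L↑   = here refl
∈-profiles B↑C    = there (here refl)
∈-profiles B↑L↑L↓ = there (there (here refl))
∈-profiles B↓L↓C  = there (there (there (here refl)))
∈-profiles L↑C    = there (there (there (there (here refl))))

by-exhaustion : ∀ (p : Profile → Bool) → T (all p profiles) → ∀ t → T (p t)
by-exhaustion p h t = All.lookup (all⁺ p profiles h) (∈-profiles t)

by-exhaustion₂ : ∀ (p : Profile → Profile → Bool) → T (all (λ t₁ → all (p t₁) profiles) profiles) →
                 ∀ t₁ t₂ → T (p t₁ t₂)
by-exhaustion₂ p h t₁ = by-exhaustion (p t₁) (by-exhaustion (λ t₁ → all (p t₁) profiles) h t₁)

-- The checks below hold by evaluation over all profiles.
combine-sound : ∀ ts → length ts ≤ 2 → ∀ {s} → s ∈ states (combine ts) → T (realisable s ts)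
combine-sound ts len = All.lookup (all⁺ _ (states (combine ts)) (checked ts len))
  where
  sound : List Profile → Bool
  sound ts = all (λ s → realisable s ts) (states (combine ts))

  checked : ∀ ts → length ts ≤ 2 → T (sound ts)
  checked []              _                  = _
  checked (t ∷ [])        _                  = by-exhaustion (λ t → sound [ t ]) _ t
  checked (t₁ ∷ t₂ ∷ [])  _                  = by-exhaustion₂ (λ t₁ t₂ → sound (t₁ ∷ t₂ ∷ [])) _ t₁ t₂
  checked (_ ∷ _ ∷ _ ∷ _) (s≤s (s≤s ()))

combine-not-leafy : ∀ t ts → T (not (leafy (combine (t ∷ ts))))
combine-not-leafy t []            = by-exhaustion (λ t → not (leafy (combine₁ t))) _ t
combine-not-leafy t (t₂ ∷ [])     = by-exhaustion₂ (λ t t₂ → not (leafy (combine₂ t t₂))) _ t t₂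
combine-not-leafy t (_ ∷ _ ∷ _)   = _

rootOK : Color → Profile → Profile → Bool
rootOK c t₁ t₂ = (leafy t₁ ∧ leafy t₂) ∨ any (λ s → realisable s (t₁ ∷ t₂ ∷ [])) (rootCandidates c)

rootOK-all : ∀ c t₁ t₂ → T (rootOK c t₁ t₂)
rootOK-all red  = by-exhaustion₂ (rootOK red) _
rootOK-all blue = by-exhaustion₂ (rootOK blue) _

root-sound : ∀ c t₁ t₂ → ¬ (T (leafy t₁) × T (leafy t₂)) →
             rootState c (t₁ ∷ t₂ ∷ []) ∈ rootCandidates c ×
             T (realisable (rootState c (t₁ ∷ t₂ ∷ [])) (t₁ ∷ t₂ ∷ []))
root-sound c t₁ t₂ not-leaves with Equivalence.to T-∨ (rootOK-all c t₁ t₂)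
... | inj₁ leaves = contradiction (Equivalence.to T-∧ leaves) not-leaves
... | inj₂ found  = firstWith-spec _ blue↑ (rootCandidates c) found

rootCandidate : ∀ {c s} → s ∈ rootCandidates c → colour s ≡ c × s ≢ leaf↑
rootCandidate {red}  (here refl)         = refl , λ ()
rootCandidate {red}  (there (here refl)) = refl , λ ()
rootCandidate {blue} (here refl)         = refl , λ ()
rootCandidate {blue} (there (here refl)) = refl , λ ()

-- Colouring a rooted tree

module Colouring {n} (G : Graph n) (connected : Connected G) (acyclic : ¬ HasCycle G) (root : Fin n)
                 (subcubic : Subcubic G) (deg-root : deg G root ≡ 2) (not-P3 : ¬ Isomorphic G P3)
                 (c : Color) where

  open RootedTree G connected acyclic root

  private
    maxDepth : ℕ
    maxDepth = max 0 (map depth (allFin n))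

    depth≤max : ∀ w → depth w ≤ maxDepth
    depth≤max w = All.lookup (xs≤max 0 (map depth (allFin n))) (∈-map⁺ depth (∈-allFin w))

  profileWith : ℕ → Fin n → Profile
  profileWith zero    w = B↑L↑
  profileWith (suc k) w = combine (map (profileWith k) (children w))

  -- The fuel suc maxDepth ∸ depth w is positive and drops by one from a vertex to its children.
  profile : Fin n → Profile
  profile w = profileWith (suc maxDepth ∸ depth w) w

  childProfiles : Fin n → List Profile
  childProfiles w = map profile (children w)

  profile-children : ∀ w → profile w ≡ combine (childProfiles w)
  profile-children w rewrite +-∸-assoc 1 (depth≤max w) =
    cong combine (map-cong-local (All.tabulate λ x∈ → cong (λ d → profileWith (suc maxDepth ∸ d) _) (≡.sym (child-depth x∈))))

  leafy⇒childless : ∀ w → T (leafy (profile w)) → children w ≡ []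
  leafy⇒childless w h with children w | profile-children w
  ... | []     | _  = refl
  ... | x ∷ xs | eq = ⊥-elim (T-not⇒¬T (combine-not-leafy (profile x) (map profile xs)) (subst (T ∘ leafy) eq h))

  stateAt : ℕ → Fin n → State
  stateAt zero    _ = rootState c (childProfiles root)
  stateAt (suc k) w = assign (children (parent w)) (choose (stateAt k (parent w)) (childProfiles (parent w))) blue↑ w

  state : Fin n → State
  state w = stateAt (depth w) w

  state-root : state root ≡ rootState c (childProfiles root)
  state-root = cong (λ k → stateAt k root) depth-root

  state-child : ∀ {w x} → x ∈ children w → state x ≡ assign (children w) (choose (state w) (childProfiles w)) blue↑ x
  state-child m rewrite child-depth m | parent-child m = refl

  children-states : ∀ w → T (realisable (state w) (childProfiles w)) →
    T (admits (state w) (map state (children w))) ×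
    InProfiles (map state (children w)) (childProfiles w)
  children-states w h =
    subst (λ cs → T (admits (state w) cs) × InProfiles cs (childProfiles w))
          (≡.sym states≡) (choose-spec h)
    where
    states≡ : map state (children w) ≡ choose (state w) (childProfiles w)
    states≡ = trans (map-cong-local (All.tabulate state-child))
      (map-assign (children w) _ blue↑ (children-unique w)
        (trans (Pointwise-length (proj₂ (choose-spec {state w} {childProfiles w} h))) (length-map profile (children w))))

  root-realisable : rootState c (childProfiles root) ∈ rootCandidates c ×
                    T (realisable (rootState c (childProfiles root)) (childProfiles root))
  root-realisable with children root in eq | root-children deg-root
  ... | x ∷ y ∷ [] | _ = root-sound c (profile x) (profile y) λ (x-leafy , y-leafy) →
    not-P3 (Cherry.cherry≅P3 eq (leafy⇒childless x x-leafy) (leafy⇒childless y y-leafy))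

  at-most-two-children : ∀ w → length (childProfiles w) ≤ 2
  at-most-two-children w rewrite length-map profile (children w) with w ≟ root
  ... | yes refl   = ≤-reflexive (root-children deg-root)
  ... | no w≢root = children-count w≢root (subcubic w)

  realisable-at : ∀ {w} → w ≡ root ⊎ state w ∈ states (profile w) → T (realisable (state w) (childProfiles w))
  realisable-at (inj₁ refl) = subst (λ s → T (realisable s (childProfiles root))) (≡.sym state-root) (proj₂ root-realisable)
  realisable-at {w} (inj₂ s∈) =
    combine-sound (childProfiles w) (at-most-two-children w) (subst (λ t → state w ∈ states t) (profile-children w) s∈)

  root-or-fits : ∀ k {w} → depth w ≡ k → w ≡ root ⊎ state w ∈ states (profile w)
  root-or-fits zero    d≡ = inj₁ (depth≡0⇒root d≡)
  root-or-fits (suc k) {w} d≡ = inj₂ (Pointwise-map-∈ (proj₂ (children-states (parent w) parent-realisable)) (child-parent w≢root))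
    where
    w≢root = depth≡suc⇒≢root d≡
    parent-realisable = realisable-at (root-or-fits k (depth-parent-suc d≡))

  admissible : ∀ w → T (admits (state w) (map state (children w)))
  admissible w = proj₁ (children-states w (realisable-at (root-or-fits (depth w) refl)))

  childrenOK-at : ∀ w → T (childrenOK (state w) (map state (children w)))
  childrenOK-at w = proj₂ (Equivalence.to T-∧ (admissible w))

  fits-parent : ∀ {w s} → state w ≡ s → w ≢ root → T (fitsUnder (state (parent w)) s)
  fits-parent {w} refl w≢root =
    all-map-∈ (fitsUnder (state (parent w))) state (proj₁ (Equivalence.to T-∧ (admissible (parent w)))) (child-parent w≢root)

  unlike-children⇒parent : ∀ {w x} (q : State → Bool) → T (all q (map state (children w))) →
                           ¬ T (q (state x)) → Adj G w x → x ≡ parent w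
  unlike-children⇒parent q all-q ¬qx e = not-child⇒parent e λ x∈ → ¬qx (all-map-∈ q state all-q x∈)

  unlike-parent⇒child : ∀ {w x} (q : State → Bool) → (w ≢ root → T (q (state (parent w)))) →
                        ¬ T (q (state x)) → Adj G w x → x ∈ children w
  unlike-parent⇒child q parent-q ¬qx e = not-parent⇒child e λ { w≢root refl → ¬qx (parent-q w≢root) }

  state-root-candidate : colour (state root) ≡ c × state root ≢ leaf↑
  state-root-candidate = subst (λ s → colour s ≡ c × s ≢ leaf↑) (≡.sym state-root) (rootCandidate (proj₁ root-realisable))

  red-child⇒red-neighbour : ∀ {w} → T (any isRed (map state (children w))) → ∃[ u ] (Adj G w u × colour (state u) ≡ red)
  red-child⇒red-neighbour h with any-map isRed state h
  ... | x , x∈ , x-red = x , child-adj x∈ , isRed⇒red x-red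

  centre-child : ∀ {w x} → state w ≡ centre → x ∈ children w → state x ≢ centre
  centre-child {w} w-centre x∈ x-centre =
    subst (λ s → T (isBlue s ∨ isLeaf↑ s)) x-centre
      (all-map-∈ (λ s → isBlue s ∨ isLeaf↑ s) state
        (proj₂ (Equivalence.to T-∧ (subst (λ s → T (childrenOK s (map state (children w)))) w-centre (childrenOK-at w)))) x∈)

  blue-partner-unique : ∀ {w u u′} → colour (state w) ≡ blue → Adj G w u → Adj G w u′ →
                        colour (state u) ≡ blue → colour (state u′) ≡ blue → u ≡ u′
  blue-partner-unique {w} w-blue e e′ u-blue u′-blue with state w in eq | childrenOK-at w | w-blue
  ... | blue↑ | all-red  | _ =
    trans (unlike-children⇒parent isRed all-red (blue⇒¬isRed u-blue) e)
          (≡.sym (unlike-children⇒parent isRed all-red (blue⇒¬isRed u′-blue) e′))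
  ... | blue↓ | one-blue | _ =
    atMostOne-map isBlue state one-blue (children-unique w)
      (unlike-parent⇒child isRed (fits-parent eq) (blue⇒¬isRed u-blue) e)
      (unlike-parent⇒child isRed (fits-parent eq) (blue⇒¬isRed u′-blue) e′)
      (blue⇒isBlue u-blue) (blue⇒isBlue u′-blue)

  red-has-red-neighbour : ∀ {w} → colour (state w) ≡ red → ∃[ u ] (Adj G w u × colour (state u) ≡ red)
  red-has-red-neighbour {w} w-red with state w in eq | childrenOK-at w | w-red
  ... | leaf↑  | _        | _ = parent w , parent-adj w≢root , isRed⇒red (fits-parent eq w≢root)
    where
    w≢root : w ≢ root
    w≢root refl = proj₂ state-root-candidate eq
  ... | leaf↓  | some-red | _ = red-child⇒red-neighbour (proj₁ (Equivalence.to T-∧ some-red))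
  ... | centre | some-red | _ = red-child⇒red-neighbour (proj₁ (Equivalence.to T-∧ some-red))

  red-branch⇒centre : ∀ {w y z} → colour (state w) ≡ red → Adj G w y → Adj G w z → y ≢ z →
                      colour (state y) ≡ red → colour (state z) ≡ red → state w ≡ centre
  red-branch⇒centre {w} w-red ey ez y≢z y-red z-red with state w in eq | childrenOK-at w | w-red
  ... | centre | _        | _ = refl
  ... | leaf↑  | all-blue | _ = ⊥-elim (y≢z (trans
    (unlike-children⇒parent isBlue all-blue (red⇒¬isBlue y-red) ey)
    (≡.sym (unlike-children⇒parent isBlue all-blue (red⇒¬isBlue z-red) ez))))
  ... | leaf↓  | some-red | _ = ⊥-elim (y≢z
    (atMostOne-map isRed state (proj₂ (Equivalence.to T-∧ some-red)) (children-unique w)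
      (unlike-parent⇒child isBlue (fits-parent eq) (red⇒¬isBlue y-red) ey)
      (unlike-parent⇒child isBlue (fits-parent eq) (red⇒¬isBlue z-red) ez)
      (red⇒isRed y-red) (red⇒isRed z-red)))

  centres-not-adjacent : ∀ {w x} → state w ≡ centre → state x ≡ centre → ¬ Adj G w x
  centres-not-adjacent w-centre x-centre e with adj-cases e
  ... | inj₂ x∈               = centre-child w-centre x∈ x-centre
  ... | inj₁ (w≢root , refl) = centre-child x-centre (child-parent w≢root) w-centre

  crumby : Crumby G (λ w → colour (state w))
  crumby = (λ _ w-blue _ _ → blue-partner-unique w-blue)
         , (λ _ → red-has-red-neighbour)
         , λ where
             (w , x , y , z , ((_ ∷ w≢y ∷ _) ∷ (_ ∷ x≢z ∷ []) ∷ _) , w-red , x-red , y-red , z-red , wx , xy , yz) →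
               centres-not-adjacent (red-branch⇒centre x-red (Adj-sym wx) xy w≢y w-red y-red)
                                    (red-branch⇒centre y-red (Adj-sym xy) yz x≢z x-red z-red) xy

theorem3p3 : ∀ {n} (T : Graph n) → Subcubic T → IsTree T → ¬ Isomorphic T P3 →
    (v : Fin n) → deg T v ≡ 2 → (c : Color) →
    Σ (Fin n → Color) λ col → Crumby T col × col v ≡ c
theorem3p3 T subcubic (connected , acyclic) not-P3 v deg-v c =
  (λ w → colour (state w)) , crumby , proj₁ state-root-candidate
  where open Colouring T connected acyclic v subcubic deg-v not-P3 c
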